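{- Let $n$ and $p$ be positive integers with $n\ge 19$ and $n>2p$, and let $k=n-2p$. For an integer $z$ with $0\le z\le\frac{n-k}{2}$, let $b(z)$ denote the remainder of $\frac{n-k}{2}-z$ upon division by $k+z$, and define \[ D(z)= -z^2+(2n+1)z+\frac{(n+k)^2}{k+z}-3n-k+4\Big(b(z)-\frac{b(z)^2}{k+z}\Big). \] Let $z^\dagger=\frac{1}{4}\big(\sqrt{8n+8k+1}-4k+1\big)$. If $z^\dagger>0$, then every integer $z^*\in[0,\frac{n-k}{2}]$ minimizing $D$ over the integers of $[0,\frac{n-k}{2}]$ satisfies $z^*\in\{\lfloor z^\dagger\rfloor,\lceil z^\dagger\rceil\}$. -}

module Defs where

open import Data.Nat.Base as ℕ using (ℕ; zero; suc; NonZero)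
open import Data.Integer.Base as ℤ using (ℤ; +_)
open import Data.Rational.Base as ℚ using (ℚ)
open import Data.Product using (_×_)
open import Data.Sum using (_⊎_)

k+z-nonZero : (k z : ℕ) → .{{NonZero k}} → NonZero (k ℕ.+ z)
k+z-nonZero (suc k) z = _

ι : ℕ → ℚ
ι m = (+ m) ℚ./ 1

b : (n k : ℕ) → .{{NonZero k}} → ℕ → ℕ
b n k z = ℕ._%_ (((n ℕ.∸ k) ℕ./ 2) ℕ.∸ z) (k ℕ.+ z) {{k+z-nonZero k z}}

D : (n k : ℕ) → .{{NonZero k}} → ℕ → ℚ
D n k z =
  ℚ.- (ι z ℚ.* ι z)
  ℚ.+ ι (2 ℕ.* n ℕ.+ 1) ℚ.* ι z
  ℚ.+ ((+ ((n ℕ.+ k) ℕ.* (n ℕ.+ k))) ℚ./ (k ℕ.+ z)) {{k+z-nonZero k z}}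
  ℚ.- ι (3 ℕ.* n)
  ℚ.- ι k
  ℚ.+ ι 4 ℚ.* (ι bz ℚ.- ((+ (bz ℕ.* bz)) ℚ./ (k ℕ.+ z)) {{k+z-nonZero k z}})
  where bz = b n k z

-- Comparisons between an integer a and the real number √S (S ≥ 0), written
-- without reals: literally unfolding the comparison with the nonnegative root.
_≤√_ : ℤ → ℕ → Set
a ≤√ S = a ℤ.≤ + 0 ⊎ a ℤ.* a ℤ.≤ + S

_<√_ : ℤ → ℕ → Set
a <√ S = a ℤ.< + 0 ⊎ a ℤ.* a ℤ.< + S

√_≤_ : ℕ → ℤ → Set
√ S ≤ a = + 0 ℤ.≤ a × + S ℤ.≤ a ℤ.* a

√_<_ : ℕ → ℤ → Set
√ S < a = + 0 ℤ.< a × + S ℤ.< a ℤ.* a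

-- S = 8n + 8k + 1, so z† = (√S - 4k + 1)/4
S : ℕ → ℕ → ℕ
S n k = 8 ℕ.* n ℕ.+ 8 ℕ.* k ℕ.+ 1

-- z† > 0   ⇔   4k - 1 < √S
zdag-pos : ℕ → ℕ → Set
zdag-pos n k = (+ (4 ℕ.* k) ℤ.- + 1) <√ S n k

-- m = ⌊z†⌋  ⇔  m ≤ z† < m + 1  ⇔  4m+4k-1 ≤ √S < 4m+4k+3
IsFloorZdag : ℕ → ℕ → ℤ → Set
IsFloorZdag n k m =
  (ℤ.+ 4 ℤ.* m ℤ.+ + (4 ℕ.* k) ℤ.- + 1) ≤√ S n k
  × √ S n k < (ℤ.+ 4 ℤ.* m ℤ.+ + (4 ℕ.* k) ℤ.+ + 3)

-- m = ⌈z†⌉  ⇔  m - 1 < z† ≤ m  ⇔  4m+4k-5 < √S ≤ 4m+4k-1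
IsCeilZdag : ℕ → ℕ → ℤ → Set
IsCeilZdag n k m =
  (ℤ.+ 4 ℤ.* m ℤ.+ + (4 ℕ.* k) ℤ.- + 5) <√ S n k
  × √ S n k ≤ (ℤ.+ 4 ℤ.* m ℤ.+ + (4 ℕ.* k) ℤ.- + 1)

-- Put N = (n + k)/2 = p + k and m = k + z. Dividing (n - k)/2 - z by m gives N = Q m + b(z)
-- with Q ≥ 1, and then D(z) = (2n + 1) z - z² - 3n - k + 4 F(z) for the integer
-- F(z) = (N² + b(z) (m - b(z))) / m, which satisfies N²/m ≤ F(z) ≤ N²/m + m/4.  Since
-- D(z + 1) - D(z) = 2 (2N - m + 2 F(z + 1) - 2 F(z)), these bounds show that D strictly
-- decreases from z to z + 1 while m (m + 1) < N, and strictly increases once 2N + m ≤ 2m²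
-- (where m ≥ 3 because N ≥ 10).  So for m = k + z* a minimiser z* satisfies
-- 2N < (m + 1)(2m + 1) and, unless z* = 0, 2(m - 1)² < 2N + (m - 1); for z* = 0 the latter
-- follows from z† > 0.  As 4 z† + 4k - 1 = √(16N + 1), comparing 2m² with 2N + m decides
-- whether z* = ⌊z†⌋ or z* = ⌈z†⌉.
module Submission where

open import Defs
open import Data.Nat.Base using (ℕ; NonZero; _≤_; _<_; _*_; _∸_; _/_)
open import Data.Integer.Base using (+_)
open import Data.Rational.Base as ℚ using (ℚ)
open import Data.Sum using (_⊎_)
open import Relation.Binary.PropositionalEquality using (_≡_)

open import Data.Nat.Base
open import Data.Nat.Properties
open import Data.Nat.DivMod using (m≡m%n+[m/n]*n; m%n<n; m*n/n≡m)
open import Data.Nat.Tactic.RingSolver using (solve; solve-∀)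
open import Data.List.Base using (_∷_; [])
open import Data.Integer.Base as ℤ using (ℤ)
import Data.Integer.Properties as ℤP
import Data.Integer.Tactic.RingSolver as ℤSolver
import Data.Rational.Properties as ℚP
open import Data.Rational.Unnormalised.Base as ℚᵘ using (mkℚᵘ; *≡*; *<*)
import Data.Rational.Unnormalised.Properties as ℚᵘP
open import Data.Rational.Solver using (module +-*-Solver)
open import Data.Product using (∃-syntax; _×_; _,_)
open import Data.Sum using (inj₁; inj₂)
open import Data.Empty using (⊥-elim)
open import Relation.Nullary using (Dec; yes; no; ¬_)
open import Relation.Binary.PropositionalEquality

m<n⇒∃[o]m+[o+1]≡n : ∀ {m n} → m < n → ∃[ o ] m + (o + 1) ≡ n
m<n⇒∃[o]m+[o+1]≡n {m} m<n with o , eq ← m≤n⇒∃[o]m+o≡n m<n =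
  o , trans (cong (_+_ m) (+-comm o 1)) (trans (+-suc m o) eq)

m≤n⇒∃[o]o+m≡n : ∀ {m n} → m ≤ n → ∃[ o ] o + m ≡ n
m≤n⇒∃[o]o+m≡n {m} m≤n with o , eq ← m≤n⇒∃[o]m+o≡n m≤n = o , trans (+-comm o m) eq

m+n≡o+p⇒m<o : ∀ {m o} n p → p < n → m + n ≡ o + p → m < o
m+n≡o+p⇒m<o {m} {o} n p p<n eq = +-cancelʳ-< n m o (begin-strict
  m + n  ≡⟨ eq ⟩
  o + p  <⟨ +-monoʳ-< o p<n ⟩
  o + n  ∎)
  where open ≤-Reasoning

four-mul-≤-square : ∀ x y → 4 * (x * y) ≤ (x + y) * (x + y)
four-mul-≤-square x y with ≤-total x y
... | inj₁ x≤y with d , refl ← m≤n⇒∃[o]m+o≡n x≤y =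
  ≤-trans (m≤m+n (4 * (x * (x + d))) (d * d)) (≤-reflexive (solve (x ∷ d ∷ [])))
... | inj₂ y≤x with d , refl ← m≤n⇒∃[o]m+o≡n y≤x =
  ≤-trans (m≤m+n (4 * ((y + d) * y)) (d * d)) (≤-reflexive (solve (y ∷ d ∷ [])))

toℚᵘ-/ : ∀ a d → ℚ.toℚᵘ (+ a ℚ./ suc d) ℚᵘ.≃ mkℚᵘ (+ a) d
toℚᵘ-/ a d = ℚP.toℚᵘ-fromℚᵘ (mkℚᵘ (+ a) d)

mkℚᵘ-≃ : ∀ {a b d e} → a * suc e ≡ b * suc d → mkℚᵘ (+ a) d ℚᵘ.≃ mkℚᵘ (+ b) e
mkℚᵘ-≃ {a} {b} {d} {e} eq = *≡* (begin
  + a ℤ.* + suc e  ≡⟨ ℤP.pos-* a (suc e) ⟨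
  + (a * suc e)    ≡⟨ cong +_ eq ⟩
  + (b * suc d)    ≡⟨ ℤP.pos-* b (suc d) ⟩
  + b ℤ.* + suc d  ∎)
  where open ≡-Reasoning

mkℚᵘ-+ : ∀ a c d e → mkℚᵘ (+ a) d ℚᵘ.+ mkℚᵘ (+ c) e ≡ mkℚᵘ (+ (a * suc e + c * suc d)) (e + d * suc e)
mkℚᵘ-+ a c d e = cong₂ mkℚᵘ (sym (cong₂ ℤ._+_ (ℤP.pos-* a (suc e)) (ℤP.pos-* c (suc d)))) refl

mkℚᵘ-* : ∀ a c d e → mkℚᵘ (+ a) d ℚᵘ.* mkℚᵘ (+ c) e ≡ mkℚᵘ (+ (a * c)) (e + d * suc e)
mkℚᵘ-* a c d e = cong₂ mkℚᵘ (sym (ℤP.pos-* a c)) refl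

ι-+ : ∀ a c → ι (a + c) ≡ ι a ℚ.+ ι c
ι-+ a c = ℚP.toℚᵘ-injective (begin
  ℚ.toℚᵘ (ι (a + c))                   ≈⟨ toℚᵘ-/ (a + c) 0 ⟩
  mkℚᵘ (+ (a + c)) 0                   ≈⟨ mkℚᵘ-≃ (solve (a ∷ c ∷ [])) ⟩
  mkℚᵘ (+ (a * 1 + c * 1)) (0 + 0 * 1) ≡⟨ mkℚᵘ-+ a c 0 0 ⟨
  mkℚᵘ (+ a) 0 ℚᵘ.+ mkℚᵘ (+ c) 0       ≈⟨ ℚᵘP.+-cong (toℚᵘ-/ a 0) (toℚᵘ-/ c 0) ⟨
  ℚ.toℚᵘ (ι a) ℚᵘ.+ ℚ.toℚᵘ (ι c)       ≈⟨ ℚP.toℚᵘ-homo-+ (ι a) (ι c) ⟨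
  ℚ.toℚᵘ (ι a ℚ.+ ι c)                 ∎)
  where open ℚᵘP.≃-Reasoning

ι-* : ∀ a c → ι (a * c) ≡ ι a ℚ.* ι c
ι-* a c = ℚP.toℚᵘ-injective (begin
  ℚ.toℚᵘ (ι (a * c))                   ≈⟨ toℚᵘ-/ (a * c) 0 ⟩
  mkℚᵘ (+ (a * c)) (0 + 0 * 1)         ≡⟨ mkℚᵘ-* a c 0 0 ⟨
  mkℚᵘ (+ a) 0 ℚᵘ.* mkℚᵘ (+ c) 0       ≈⟨ ℚᵘP.*-cong (toℚᵘ-/ a 0) (toℚᵘ-/ c 0) ⟨
  ℚ.toℚᵘ (ι a) ℚᵘ.* ℚ.toℚᵘ (ι c)       ≈⟨ ℚP.toℚᵘ-homo-* (ι a) (ι c) ⟨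
  ℚ.toℚᵘ (ι a ℚ.* ι c)                 ∎)
  where open ℚᵘP.≃-Reasoning

ι+ι*/ : ∀ W c r d → ι W ℚ.+ ι c ℚ.* (+ r ℚ./ suc d) ≡ + (suc d * W + c * r) ℚ./ suc d
ι+ι*/ W c r d = ℚP.toℚᵘ-injective (begin
  ℚ.toℚᵘ (ι W ℚ.+ ι c ℚ.* (+ r ℚ./ suc d))
    ≈⟨ ℚᵘP.≃-trans (ℚP.toℚᵘ-homo-+ (ι W) _) (ℚᵘP.+-cong (toℚᵘ-/ W 0) (ℚP.toℚᵘ-homo-* (ι c) _)) ⟩
  mkℚᵘ (+ W) 0 ℚᵘ.+ ℚ.toℚᵘ (ι c) ℚᵘ.* ℚ.toℚᵘ (+ r ℚ./ suc d)
    ≈⟨ ℚᵘP.+-congʳ (mkℚᵘ (+ W) 0) (ℚᵘP.*-cong (toℚᵘ-/ c 0) (toℚᵘ-/ r d)) ⟩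
  mkℚᵘ (+ W) 0 ℚᵘ.+ mkℚᵘ (+ c) 0 ℚᵘ.* mkℚᵘ (+ r) d
    ≡⟨ cong (mkℚᵘ (+ W) 0 ℚᵘ.+_) (mkℚᵘ-* c r 0 d) ⟩
  mkℚᵘ (+ W) 0 ℚᵘ.+ mkℚᵘ (+ (c * r)) (d + 0 * suc d)
    ≡⟨ mkℚᵘ-+ W (c * r) 0 (d + 0 * suc d) ⟩
  mkℚᵘ (+ (W * suc (d + 0 * suc d) + c * r * 1)) (d + 0 * suc d + 0 * suc (d + 0 * suc d))
    ≈⟨ mkℚᵘ-≃ (solve (W ∷ c ∷ r ∷ d ∷ [])) ⟩
  mkℚᵘ (+ (suc d * W + c * r)) d
    ≈⟨ toℚᵘ-/ (suc d * W + c * r) d ⟨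
  ℚ.toℚᵘ (+ (suc d * W + c * r) ℚ./ suc d) ∎)
  where open ℚᵘP.≃-Reasoning

ι-mono-< : ∀ {a c} → a < c → ι a ℚ.< ι c
ι-mono-< {a} {c} a<c = ℚP.toℚᵘ-cancel-<
  (ℚᵘP.<-respʳ-≃ (ℚᵘP.≃-sym (toℚᵘ-/ c 0)) (ℚᵘP.<-respˡ-≃ (ℚᵘP.≃-sym (toℚᵘ-/ a 0))
    (*<* (ℤP.*-monoʳ-<-pos (+ 1) (ℤ.+<+ a<c)))))

ι-sub-mono-< : ∀ {a₁ b₁ a₂ b₂} → a₁ + b₂ < a₂ + b₁ → ι a₁ ℚ.- ι b₁ ℚ.< ι a₂ ℚ.- ι b₂
ι-sub-mono-< {a₁} {b₁} {a₂} {b₂} h = subst₂ ℚ._<_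
  (trans (cong (ℚ._- total) (ι-+ a₁ b₂)) (solveℚ 3 (λ x y z → (x :+ y) :- (z :+ y) := x :- z) refl (ι a₁) (ι b₂) (ι b₁)))
  (trans (cong (ℚ._- total) (ι-+ a₂ b₁)) (solveℚ 3 (λ x y z → (x :+ y) :- (y :+ z) := x :- z) refl (ι a₂) (ι b₁) (ι b₂)))
  (ℚP.+-monoˡ-< (ℚ.- total) (ι-mono-< h))
  where
  open +-*-Solver using (_:+_; _:-_; _:=_) renaming (solve to solveℚ)
  total : ℚ
  total = ι b₁ ℚ.+ ι b₂

ℚ<⇒≱ : ∀ {x y} → x ℚ.< y → ¬ (y ℚ.≤ x)
ℚ<⇒≱ x<y y≤x = ℚP.<-irrefl refl (ℚP.<-≤-trans x<y y≤x)

-- (n + k)² / (k + z) = W + 4β² / (k + z), and this fractional part cancels the -4β² / (k + z) in D.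
D-closed-form : ∀ n k′ z W → let k = suc k′; β = b n k z in
  (n + k) * (n + k) ≡ (k + z) * W + 4 * (β * β) →
  D n k z ≡ ι ((2 * n + 1) * z + W + 4 * β) ℚ.- ι (z * z + 3 * n + k)
D-closed-form n k′ z W square = begin
  D n k z
    ≡⟨ cong (λ t → ℚ.- (ι z ℚ.* ι z) ℚ.+ ι (2 * n + 1) ℚ.* ι z ℚ.+ t ℚ.- ι (3 * n) ℚ.- ι k ℚ.+ ι 4 ℚ.* (ι β ℚ.- v))
            (trans (cong (λ x → + x ℚ./ suc (k′ + z)) square) (sym (ι+ι*/ W 4 (β * β) (k′ + z)))) ⟩
  ℚ.- (ι z ℚ.* ι z) ℚ.+ ι (2 * n + 1) ℚ.* ι z ℚ.+ (ι W ℚ.+ ι 4 ℚ.* v) ℚ.- ι (3 * n) ℚ.- ι k ℚ.+ ι 4 ℚ.* (ι β ℚ.- v)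
    ≡⟨ solveℚ 8 (λ Z A W′ F V T K B →
                 :- (Z :* Z) :+ A :* Z :+ (W′ :+ F :* V) :- T :- K :+ F :* (B :- V)
              := (A :* Z :+ W′ :+ F :* B) :- (Z :* Z :+ T :+ K))
            refl (ι z) (ι (2 * n + 1)) (ι W) (ι 4) v (ι (3 * n)) (ι k) (ι β) ⟩
  (ι (2 * n + 1) ℚ.* ι z ℚ.+ ι W ℚ.+ ι 4 ℚ.* ι β) ℚ.- (ι z ℚ.* ι z ℚ.+ ι (3 * n) ℚ.+ ι k)
    ≡⟨ cong₂ ℚ._-_ ι-gains ι-losses ⟨
  ι ((2 * n + 1) * z + W + 4 * β) ℚ.- ι (z * z + 3 * n + k) ∎
  where
  open ≡-Reasoning
  open +-*-Solver using (_:+_; _:*_; :-_; _:-_; _:=_) renaming (solve to solveℚ)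
  k β : ℕ
  k = suc k′
  β = b n k z
  v : ℚ
  v = + (β * β) ℚ./ suc (k′ + z)
  ι-gains : ι ((2 * n + 1) * z + W + 4 * β) ≡ ι (2 * n + 1) ℚ.* ι z ℚ.+ ι W ℚ.+ ι 4 ℚ.* ι β
  ι-gains = trans (ι-+ ((2 * n + 1) * z + W) (4 * β))
    (cong₂ ℚ._+_ (trans (ι-+ ((2 * n + 1) * z) W) (cong (ℚ._+ ι W) (ι-* (2 * n + 1) z))) (ι-* 4 β))
  ι-losses : ι (z * z + 3 * n + k) ≡ ι z ℚ.* ι z ℚ.+ ι (3 * n) ℚ.+ ι k
  ι-losses = trans (ι-+ (z * z + 3 * n) k)
    (cong (ℚ._+ ι k) (trans (ι-+ (z * z) (3 * n)) (cong (ℚ._+ ι (3 * n)) (ι-* z z))))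

-- For N = Q m + c with c ≤ m, m · F Q m c = N² + c (m - c); this is the paper's
-- (n + k)² / (4 (k + z)) + b - b² / (k + z) with N = (n + k)/2, m = k + z and c = b.
F : ℕ → ℕ → ℕ → ℕ
F Q m c = Q * Q * m + 2 * Q * c + c

F-lower : ∀ Q m c → c ≤ m → (Q * m + c) * (Q * m + c) ≤ m * F Q m c
F-lower Q m c c≤m with d , refl ← m≤n⇒∃[o]m+o≡n c≤m = begin
  (Q * (c + d) + c) * (Q * (c + d) + c)              ≤⟨ m≤m+n _ (c * d) ⟩
  (Q * (c + d) + c) * (Q * (c + d) + c) + c * d      ≡⟨ solve (Q ∷ c ∷ d ∷ []) ⟩
  (c + d) * (Q * Q * (c + d) + 2 * Q * c + c)        ∎
  where open ≤-Reasoning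

F-upper : ∀ Q m c → c ≤ m → 4 * (m * F Q m c) ≤ 4 * ((Q * m + c) * (Q * m + c)) + m * m
F-upper Q m c c≤m with d , refl ← m≤n⇒∃[o]m+o≡n c≤m = begin
  4 * ((c + d) * (Q * Q * (c + d) + 2 * Q * c + c))               ≡⟨ solve (Q ∷ c ∷ d ∷ []) ⟩
  4 * ((Q * (c + d) + c) * (Q * (c + d) + c)) + 4 * (c * d)       ≤⟨ +-monoʳ-≤ _ (four-mul-≤-square c d) ⟩
  4 * ((Q * (c + d) + c) * (Q * (c + d) + c)) + (c + d) * (c + d) ∎
  where open ≤-Reasoning

euclid-square : ∀ Q m c → (2 * (Q * m + c)) * (2 * (Q * m + c)) ≡ m * (4 * (Q * Q * m + 2 * Q * c)) + 4 * (c * c)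
euclid-square = solve-∀

D-difference : ∀ p k z F₀ F₁ → let n = 2 * p + k in
  (2 * n + 1) * suc z + 4 * F₁ + (z * z + 3 * n + k) + 2 * (2 * F₀ + (k + z))
  ≡ (2 * n + 1) * z + 4 * F₀ + (suc z * suc z + 3 * n + k) + 2 * (2 * (p + k) + 2 * F₁)
D-difference = solve-∀

2p+k+k≡2[p+k] : ∀ p k → 2 * p + k + k ≡ 2 * (p + k)
2p+k+k≡2[p+k] = solve-∀

descent-gap : ∀ m e → let N = m * (m + 1) + (e + 1) in
  4 * m * (m + 1) * N + m * (4 * (N * N) + (m + 1) * (m + 1)) < 4 * (m + 1) * (N * N) + 2 * m * m * (m + 1)
descent-gap m e =
  m+n≡o+p⇒m<o (4 * (m * (m + 1) + (e + 1)) * (e + 1) + m * m * (m + 1)) (m * (m + 1))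
    (begin-strict
      m * (m + 1)                                             <⟨ m<m+n (m * (m + 1)) (m≤n+m 1 e) ⟩
      m * (m + 1) + (e + 1)                                   ≤⟨ m≤n*m (m * (m + 1) + (e + 1)) 4 ⟩
      4 * (m * (m + 1) + (e + 1))                             ≤⟨ m≤m*n _ (e + 1) {{>-nonZero (m≤n+m 1 e)}} ⟩
      4 * (m * (m + 1) + (e + 1)) * (e + 1)                   ≤⟨ m≤m+n _ (m * m * (m + 1)) ⟩
      4 * (m * (m + 1) + (e + 1)) * (e + 1) + m * m * (m + 1) ∎)
    (identity m e)
  where
  open ≤-Reasoning
  -- the gap is 4N (N - m(m + 1)) + m (m + 1)(m - 1)
  identity : ∀ m e → let N = m * (m + 1) + (e + 1) in
    4 * m * (m + 1) * N + m * (4 * (N * N) + (m + 1) * (m + 1)) + (4 * N * (e + 1) + m * m * (m + 1))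
    ≡ 4 * (m + 1) * (N * N) + 2 * m * m * (m + 1) + m * (m + 1)
  identity = solve-∀

descent-inequality : ∀ {N m F₀ F₁} → m * (m + 1) < N → N * N ≤ m * F₀ →
  4 * ((m + 1) * F₁) ≤ 4 * (N * N) + (m + 1) * (m + 1) → 2 * N + 2 * F₁ < 2 * F₀ + m
descent-inequality {N} {m} {F₀} {F₁} m[m+1]<N lower upper
  with e , refl ← m<n⇒∃[o]m+[o+1]≡n m[m+1]<N =
  *-cancelˡ-< (2 * m * (m + 1)) _ _ (begin-strict
    2 * m * (m + 1) * (2 * N + 2 * F₁)
      ≡⟨ solve (m ∷ e ∷ F₁ ∷ []) ⟩
    4 * m * (m + 1) * N + m * (4 * ((m + 1) * F₁))
      ≤⟨ +-monoʳ-≤ (4 * m * (m + 1) * N) (*-monoʳ-≤ m upper) ⟩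
    4 * m * (m + 1) * N + m * (4 * (N * N) + (m + 1) * (m + 1))
      <⟨ descent-gap m e ⟩
    4 * (m + 1) * (N * N) + 2 * m * m * (m + 1)
      ≤⟨ +-monoˡ-≤ (2 * m * m * (m + 1)) (*-monoʳ-≤ (4 * (m + 1)) lower) ⟩
    4 * (m + 1) * (m * F₀) + 2 * m * m * (m + 1)
      ≡⟨ solve (m ∷ F₀ ∷ []) ⟩
    2 * m * (m + 1) * (2 * F₀ + m) ∎)
  where open ≤-Reasoning

ascent-gap : ∀ t a → let m = t + 3; N = m + (a + 1) in 2 * N + m ≤ 2 * m * m →
  (m + 1) * (4 * (N * N) + m * m) + 2 * m * m * (m + 1) < 4 * m * (m + 1) * N + 4 * m * (N * N)
ascent-gap t a 2N+m≤2m² =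
  m+n≡o+p⇒m<o ((t + 4) * (t + 1) * (t + 5) + 2 * a * (t + 1) + 2 * a * ((2 * t + 7) * (t + 1))) (2 * a * (2 * a))
    (begin-strict
      2 * a * (2 * a)                         ≤⟨ *-monoʳ-≤ (2 * a) 2a≤[2m+1][m-2] ⟩
      2 * a * ((2 * t + 7) * (t + 1))         <⟨ m<n+m _ 0<cubic ⟩
      (t + 4) * (t + 1) * (t + 5) + 2 * a * (t + 1) + 2 * a * ((2 * t + 7) * (t + 1)) ∎)
    (identity t a)
  where
  open ≤-Reasoning
  2a≤[2m+1][m-2] : 2 * a ≤ (2 * t + 7) * (t + 1)
  2a≤[2m+1][m-2] = +-cancelʳ-≤ (3 * t + 11) _ _ (begin
    2 * a + (3 * t + 11)                     ≡⟨ solve (t ∷ a ∷ []) ⟩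
    2 * (t + 3 + (a + 1)) + (t + 3)          ≤⟨ 2N+m≤2m² ⟩
    2 * (t + 3) * (t + 3)                    ≡⟨ solve (t ∷ []) ⟩
    (2 * t + 7) * (t + 1) + (3 * t + 11)     ∎)
  0<cubic : 0 < (t + 4) * (t + 1) * (t + 5) + 2 * a * (t + 1)
  0<cubic = ≤-trans (*-mono-≤ (*-mono-≤ (0<t+suc 3) (0<t+suc 0)) (0<t+suc 4)) (m≤m+n _ _)
    where
    0<t+suc : ∀ j → 0 < t + suc j
    0<t+suc j = ≤-trans (s≤s z≤n) (m≤n+m (suc j) t)
  -- with m = t + 3 the gap is (m + 1)(m - 2)(m + 2) + 2a (m - 2) + 2a ((2m + 1)(m - 2) - 2a)
  identity : ∀ t a → let m = t + 3; N = m + (a + 1) in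
    (m + 1) * (4 * (N * N) + m * m) + 2 * m * m * (m + 1)
      + ((t + 4) * (t + 1) * (t + 5) + 2 * a * (t + 1) + 2 * a * ((2 * t + 7) * (t + 1)))
    ≡ 4 * m * (m + 1) * N + 4 * m * (N * N) + 2 * a * (2 * a)
  identity = solve-∀

ascent-inequality : ∀ {N m F₀ F₁} → 3 ≤ m → m < N → 2 * N + m ≤ 2 * m * m →
  4 * (m * F₀) ≤ 4 * (N * N) + m * m → N * N ≤ (m + 1) * F₁ → 2 * F₀ + m < 2 * N + 2 * F₁
ascent-inequality {N} {m} {F₀} {F₁} 3≤m m<N 2N+m≤2m² upper lower
  with t , refl ← m≤n⇒∃[o]o+m≡n 3≤m | a , refl ← m<n⇒∃[o]m+[o+1]≡n m<N =
  *-cancelˡ-< (2 * m * (m + 1)) _ _ (begin-strict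
    2 * m * (m + 1) * (2 * F₀ + m)
      ≡⟨ solve (t ∷ F₀ ∷ []) ⟩
    (m + 1) * (4 * (m * F₀)) + 2 * m * m * (m + 1)
      ≤⟨ +-monoˡ-≤ (2 * m * m * (m + 1)) (*-monoʳ-≤ (m + 1) upper) ⟩
    (m + 1) * (4 * (N * N) + m * m) + 2 * m * m * (m + 1)
      <⟨ ascent-gap t a 2N+m≤2m² ⟩
    4 * m * (m + 1) * N + 4 * m * (N * N)
      ≤⟨ +-monoʳ-≤ (4 * m * (m + 1) * N) (*-monoʳ-≤ (4 * m) lower) ⟩
    4 * m * (m + 1) * N + 4 * m * ((m + 1) * F₁)
      ≡⟨ solve (t ∷ a ∷ F₁ ∷ []) ⟩
    2 * m * (m + 1) * (2 * N + 2 * F₁) ∎)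
  where open ≤-Reasoning

[m+1][2m+1]≤2N⇒m[m+1]<N : ∀ N m → (m + 1) * (2 * m + 1) ≤ 2 * N → m * (m + 1) < N
[m+1][2m+1]≤2N⇒m[m+1]<N N m h = *-cancelˡ-< 2 (m * (m + 1)) N (begin-strict
  2 * (m * (m + 1))              <⟨ m<m+n (2 * (m * (m + 1))) (m≤n+m 1 m) ⟩
  2 * (m * (m + 1)) + (m + 1)    ≡⟨ solve (m ∷ []) ⟩
  (m + 1) * (2 * m + 1)          ≤⟨ h ⟩
  2 * N                          ∎)
  where open ≤-Reasoning

2N+m≤2m²⇒3≤m : ∀ N m → 20 ≤ 2 * N → 2 * N + m ≤ 2 * m * m → 3 ≤ m
2N+m≤2m²⇒3≤m N m 20≤2N h = ≮⇒≥ λ m<3 → <⇒≱ (m<m+n 8 {12} (s≤s z≤n)) (begin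
  20          ≤⟨ 20≤2N ⟩
  2 * N       ≤⟨ m≤m+n (2 * N) m ⟩
  2 * N + m   ≤⟨ h ⟩
  2 * m * m   ≤⟨ *-mono-≤ (*-monoʳ-≤ 2 (s≤s⁻¹ m<3)) (s≤s⁻¹ m<3) ⟩
  8           ∎)
  where open ≤-Reasoning

[u-c]² : ∀ u c → (+ u ℤ.- + c) ℤ.* (+ u ℤ.- + c) ≡ + (u * u + c * c) ℤ.- + (2 * u * c)
[u-c]² u c = begin
  (+ u ℤ.- + c) ℤ.* (+ u ℤ.- + c)                         ≡⟨ expand (+ u) (+ c) ⟩
  (+ u ℤ.* + u ℤ.+ + c ℤ.* + c) ℤ.- ℤ.+ 2 ℤ.* + u ℤ.* + c ≡⟨ cong₂ ℤ._-_ squares double ⟨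
  + (u * u + c * c) ℤ.- + (2 * u * c)                     ∎
  where
  open ≡-Reasoning
  expand : ∀ (x y : ℤ) → (x ℤ.- y) ℤ.* (x ℤ.- y) ≡ (x ℤ.* x ℤ.+ y ℤ.* y) ℤ.- ℤ.+ 2 ℤ.* x ℤ.* y
  expand = ℤSolver.solve-∀
  squares : + (u * u + c * c) ≡ + u ℤ.* + u ℤ.+ + c ℤ.* + c
  squares = trans (ℤP.pos-+ (u * u) (c * c)) (cong₂ ℤ._+_ (ℤP.pos-* u u) (ℤP.pos-* c c))
  double : + (2 * u * c) ≡ ℤ.+ 2 ℤ.* + u ℤ.* + c
  double = trans (ℤP.pos-* (2 * u) c) (cong (ℤ._* + c) (ℤP.pos-* 2 u))

[s+y]⊖y≡s : ∀ s y → (s + y) ℤ.⊖ y ≡ + s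
[s+y]⊖y≡s s y = trans (ℤP.⊖-≥ (m≤n+m y s)) (cong +_ (m+n∸n≡m s y))

x≤s+y⇒x-y≤s : ∀ {x y s} → x ≤ s + y → + x ℤ.- + y ℤ.≤ + s
x≤s+y⇒x-y≤s {x} {y} {s} h = begin
  + x ℤ.- + y    ≡⟨ ℤP.[+m]-[+n]≡m⊖n x y ⟩
  x ℤ.⊖ y        ≤⟨ ℤP.⊖-monoˡ-≤ y h ⟩
  (s + y) ℤ.⊖ y  ≡⟨ [s+y]⊖y≡s s y ⟩
  + s            ∎
  where open ℤP.≤-Reasoning

x<s+y⇒x-y<s : ∀ {x y s} → x < s + y → + x ℤ.- + y ℤ.< + s
x<s+y⇒x-y<s {x} {y} {s} h = begin-strict
  + x ℤ.- + y    ≡⟨ ℤP.[+m]-[+n]≡m⊖n x y ⟩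
  x ℤ.⊖ y        <⟨ ℤP.⊖-monoˡ-< y h ⟩
  (s + y) ℤ.⊖ y  ≡⟨ [s+y]⊖y≡s s y ⟩
  + s            ∎
  where open ℤP.≤-Reasoning

s+y≤x⇒s≤x-y : ∀ {x y s} → s + y ≤ x → + s ℤ.≤ + x ℤ.- + y
s+y≤x⇒s≤x-y {x} {y} {s} h = begin
  + s            ≡⟨ [s+y]⊖y≡s s y ⟨
  (s + y) ℤ.⊖ y  ≤⟨ ℤP.⊖-monoˡ-≤ y h ⟩
  x ℤ.⊖ y        ≡⟨ ℤP.[+m]-[+n]≡m⊖n x y ⟨
  + x ℤ.- + y    ∎
  where open ℤP.≤-Reasoning

x-y<s⇒x<s+y : ∀ {x y s} → + x ℤ.- + y ℤ.< + s → x < s + y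
x-y<s⇒x<s+y h = ≰⇒> (λ s+y≤x → ℤP.<⇒≱ h (s+y≤x⇒s≤x-y s+y≤x))

≤√-intro : ∀ {u c S} → u * u + c * c ≤ S + 2 * u * c → (+ u ℤ.- + c) ≤√ S
≤√-intro {u} {c} h = inj₂ (subst (ℤ._≤ _) (sym ([u-c]² u c)) (x≤s+y⇒x-y≤s h))

<√-intro : ∀ {u c S} → u * u + c * c < S + 2 * u * c → (+ u ℤ.- + c) <√ S
<√-intro {u} {c} h = inj₂ (subst (ℤ._< _) (sym ([u-c]² u c)) (x<s+y⇒x-y<s h))

<√-elim : ∀ {u c S} → c ≤ u → (+ u ℤ.- + c) <√ S → u * u + c * c < S + 2 * u * c
<√-elim c≤u (inj₁ u-c<0) = ⊥-elim (ℤP.<⇒≱ u-c<0 (s+y≤x⇒s≤x-y c≤u))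
<√-elim {u} {c} _ (inj₂ [u-c]²<S) = x-y<s⇒x<s+y (subst (ℤ._< _) ([u-c]² u c) [u-c]²<S)

√<-intro : ∀ {u c S} → S < (u + c) * (u + c) → √ S < (+ u ℤ.+ + c)
√<-intro {u} {c} h =
  ℤ.+<+ (base-pos (u + c) (≤-<-trans z≤n h)) , subst (_ ℤ.<_) (ℤP.pos-* (u + c) (u + c)) (ℤ.+<+ h)
  where
  base-pos : ∀ x → 0 < x * x → 0 < x
  base-pos (suc x) _ = s≤s z≤n

√≤-intro : ∀ {u c S} → c ≤ u → S + 2 * u * c ≤ u * u + c * c → √ S ≤ (+ u ℤ.- + c)
√≤-intro {u} {c} c≤u h = s+y≤x⇒s≤x-y c≤u , subst (_ ℤ.≤_) (sym ([u-c]² u c)) (s+y≤x⇒s≤x-y h)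

floor-bounds : ∀ N m → 2 * m * m ≤ 2 * N + m → 2 * N < (m + 1) * (2 * m + 1) →
  ((+ (4 * m) ℤ.- + 1) ≤√ (16 * N + 1)) × (√ (16 * N + 1) < (+ (4 * m) ℤ.+ + 3))
floor-bounds N m lower upper = ≤√-intro {4 * m} {1} (begin
    4 * m * (4 * m) + 1 * 1          ≡⟨ solve (m ∷ []) ⟩
    8 * (2 * m * m) + 1              ≤⟨ +-monoˡ-≤ 1 (*-monoʳ-≤ 8 lower) ⟩
    8 * (2 * N + m) + 1              ≡⟨ solve (N ∷ m ∷ []) ⟩
    16 * N + 1 + 2 * (4 * m) * 1     ∎)
  , √<-intro {4 * m} {3} (begin-strict
    16 * N + 1                       ≡⟨ solve (N ∷ []) ⟩
    8 * (2 * N) + 1                  <⟨ +-monoˡ-< 1 (*-monoʳ-< 8 upper) ⟩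
    8 * ((m + 1) * (2 * m + 1)) + 1  ≡⟨ solve (m ∷ []) ⟩
    (4 * m + 3) * (4 * m + 3)        ∎)
  where open ≤-Reasoning

ceil-bounds : ∀ N m → 1 ≤ m → 2 * m * m + 3 < 2 * N + 5 * m → 2 * N + m ≤ 2 * m * m →
  ((+ (4 * m) ℤ.- + 5) <√ (16 * N + 1)) × (√ (16 * N + 1) ≤ (+ (4 * m) ℤ.- + 1))
ceil-bounds N m 1≤m lower upper = <√-intro {4 * m} {5} (begin-strict
    4 * m * (4 * m) + 5 * 5          ≡⟨ solve (m ∷ []) ⟩
    8 * (2 * m * m + 3) + 1          <⟨ +-monoˡ-< 1 (*-monoʳ-< 8 lower) ⟩
    8 * (2 * N + 5 * m) + 1          ≡⟨ solve (N ∷ m ∷ []) ⟩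
    16 * N + 1 + 2 * (4 * m) * 5     ∎)
  , √≤-intro {4 * m} {1} (≤-trans 1≤m (m≤n*m m 4)) (begin
    16 * N + 1 + 2 * (4 * m) * 1     ≡⟨ solve (N ∷ m ∷ []) ⟩
    8 * (2 * N + m) + 1              ≤⟨ +-monoˡ-≤ 1 (*-monoʳ-≤ 8 upper) ⟩
    8 * (2 * m * m) + 1              ≡⟨ solve (m ∷ []) ⟩
    4 * m * (4 * m) + 1 * 1          ∎)
  where open ≤-Reasoning

2m²<2N+m⇒2m²+3<2N+5m : ∀ N m → 1 ≤ m → 2 * m * m < 2 * N + m → 2 * m * m + 3 < 2 * N + 5 * m
2m²<2N+m⇒2m²+3<2N+5m N m 1≤m h = begin-strict
  2 * m * m + 3          <⟨ +-monoˡ-< 3 h ⟩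
  2 * N + m + 3          ≤⟨ +-monoʳ-≤ (2 * N + m) (≤-trans (s≤s (s≤s (s≤s z≤n))) (*-monoʳ-≤ 4 1≤m)) ⟩
  2 * N + m + 4 * m      ≡⟨ solve (N ∷ m ∷ []) ⟩
  2 * N + 5 * m          ∎
  where open ≤-Reasoning

2m²<2N+m⇒2[m+1]²+3<2N+5[m+1] : ∀ N m → 2 * m * m < 2 * N + m →
  2 * (m + 1) * (m + 1) + 3 < 2 * N + 5 * (m + 1)
2m²<2N+m⇒2[m+1]²+3<2N+5[m+1] N m h = begin-strict
  2 * (m + 1) * (m + 1) + 3    ≡⟨ solve (m ∷ []) ⟩
  2 * m * m + (4 * m + 5)      <⟨ +-monoˡ-< (4 * m + 5) h ⟩
  2 * N + m + (4 * m + 5)      ≡⟨ solve (N ∷ m ∷ []) ⟩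
  2 * N + 5 * (m + 1)          ∎
  where open ≤-Reasoning

4zs+4k≡4[k+zs] : ∀ k zs → ℤ.+ 4 ℤ.* + zs ℤ.+ + (4 * k) ≡ + (4 * (k + zs))
4zs+4k≡4[k+zs] k zs = begin
  ℤ.+ 4 ℤ.* + zs ℤ.+ + (4 * k)  ≡⟨ cong (ℤ._+ + (4 * k)) (ℤP.pos-* 4 zs) ⟨
  + (4 * zs + 4 * k)            ≡⟨ cong +_ (solve (k ∷ zs ∷ [])) ⟩
  + (4 * (k + zs))              ∎
  where open ≡-Reasoning

IsFloorZdag-intro : ∀ n k N zs → S n k ≡ 16 * N + 1 → let m = k + zs in
  2 * m * m ≤ 2 * N + m → 2 * N < (m + 1) * (2 * m + 1) → IsFloorZdag n k (+ zs)
IsFloorZdag-intro n k N zs S≡ lower upper =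
  subst₂ (λ x T → ((x ℤ.- + 1) ≤√ T) × (√ T < (x ℤ.+ + 3)))
    (sym (4zs+4k≡4[k+zs] k zs)) (sym S≡) (floor-bounds N (k + zs) lower upper)

IsCeilZdag-intro : ∀ n k N zs → S n k ≡ 16 * N + 1 → let m = k + zs in
  1 ≤ m → 2 * m * m + 3 < 2 * N + 5 * m → 2 * N + m ≤ 2 * m * m → IsCeilZdag n k (+ zs)
IsCeilZdag-intro n k N zs S≡ 1≤m lower upper =
  subst₂ (λ x T → ((x ℤ.- + 5) <√ T) × (√ T ≤ (x ℤ.- + 1)))
    (sym (4zs+4k≡4[k+zs] k zs)) (sym S≡) (ceil-bounds N (k + zs) 1≤m lower upper)

zdag-pos⇒2k²<2N+k : ∀ n k N → S n k ≡ 16 * N + 1 → 1 ≤ k → zdag-pos n k → 2 * k * k < 2 * N + k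
zdag-pos⇒2k²<2N+k n k N S≡ 1≤k pos = *-cancelˡ-< 8 _ _ (+-cancelʳ-< 1 _ _ (begin-strict
    8 * (2 * k * k) + 1              ≡⟨ solve (k ∷ []) ⟩
    4 * k * (4 * k) + 1 * 1          <⟨ <√-elim {4 * k} {1} (≤-trans 1≤k (m≤n*m k 4)) (subst ((+ (4 * k) ℤ.- + 1) <√_) S≡ pos) ⟩
    16 * N + 1 + 2 * (4 * k) * 1     ≡⟨ solve (N ∷ k ∷ []) ⟩
    8 * (2 * N + k) + 1              ∎))
  where open ≤-Reasoning

S≡16[p+k]+1 : ∀ p k → 8 * (2 * p + k) + 8 * k + 1 ≡ 16 * (p + k) + 1
S≡16[p+k]+1 = solve-∀

module _ (p k′ : ℕ) where

  private
    k n N : ℕ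
    k = suc k′
    n = 2 * p + k
    N = p + k

  [n∸k]/2≡p : (n ∸ k) / 2 ≡ p
  [n∸k]/2≡p = trans (cong (_/ 2) (trans (m+n∸n≡m (2 * p) k) (*-comm 2 p))) (m*n/n≡m p 2)

  Q : ℕ → ℕ
  Q z = suc (((n ∸ k) / 2 ∸ z) / (k + z))

  N≡Q*[k+z]+b : ∀ {z} → z ≤ p → N ≡ Q z * (k + z) + b n k z
  N≡Q*[k+z]+b {z} z≤p = begin
    p + k                                       ≡⟨ cong (_+ k) (trans (m∸n+n≡m z≤[n∸k]/2) [n∸k]/2≡p) ⟨
    r + z + k                                   ≡⟨ cong (λ x → x + z + k) (m≡m%n+[m/n]*n r (k + z)) ⟩
    r % (k + z) + r / (k + z) * (k + z) + z + k ≡⟨ regroup (r % (k + z)) (r / (k + z)) z k ⟩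
    suc (r / (k + z)) * (k + z) + r % (k + z)   ∎
    where
    open ≡-Reasoning
    r : ℕ
    r = (n ∸ k) / 2 ∸ z
    z≤[n∸k]/2 : z ≤ (n ∸ k) / 2
    z≤[n∸k]/2 = subst (z ≤_) (sym [n∸k]/2≡p) z≤p
    regroup : ∀ c q x y → c + q * (y + x) + x + y ≡ suc q * (y + x) + c
    regroup = solve-∀

  Fz : ℕ → ℕ
  Fz z = F (Q z) (k + z) (b n k z)

  b≤k+z : ∀ z → b n k z ≤ k + z
  b≤k+z z = <⇒≤ (m%n<n ((n ∸ k) / 2 ∸ z) (k + z))

  Fz-lower : ∀ {z} → z ≤ p → N * N ≤ (k + z) * Fz z
  Fz-lower {z} z≤p = subst (λ x → x * x ≤ (k + z) * Fz z) (sym (N≡Q*[k+z]+b z≤p))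
    (F-lower (Q z) (k + z) (b n k z) (b≤k+z z))

  Fz-upper : ∀ {z} → z ≤ p → 4 * ((k + z) * Fz z) ≤ 4 * (N * N) + (k + z) * (k + z)
  Fz-upper {z} z≤p =
    subst (λ x → 4 * ((k + z) * Fz z) ≤ 4 * (x * x) + (k + z) * (k + z)) (sym (N≡Q*[k+z]+b z≤p))
      (F-upper (Q z) (k + z) (b n k z) (b≤k+z z))

  A B : ℕ → ℕ
  A z = (2 * n + 1) * z + 4 * Fz z
  B z = z * z + 3 * n + k

  D≡ιA-ιB : ∀ {z} → z ≤ p → D n k z ≡ ι (A z) ℚ.- ι (B z)
  D≡ιA-ιB {z} z≤p = trans (D-closed-form n k′ z (4 * G) square)
    (cong (λ x → ι x ℚ.- ι (B z))
      (trans (+-assoc ((2 * n + 1) * z) (4 * G) (4 * c)) (cong (_+_ ((2 * n + 1) * z)) (sym (*-distribˡ-+ 4 G c)))))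
    where
    c G : ℕ
    c = b n k z
    G = Q z * Q z * (k + z) + 2 * Q z * c
    square : (n + k) * (n + k) ≡ (k + z) * (4 * G) + 4 * (c * c)
    square = trans (cong (λ x → x * x) (trans (2p+k+k≡2[p+k] p k) (cong (2 *_) (N≡Q*[k+z]+b z≤p))))
      (euclid-square (Q z) (k + z) c)

  k+[1+z]≡k+z+1 : ∀ z → k + suc z ≡ k + z + 1
  k+[1+z]≡k+z+1 z = trans (+-suc k z) (+-comm 1 (k + z))

  D-step-down : ∀ {z} → suc z ≤ p → 2 * N + 2 * Fz (suc z) < 2 * Fz z + (k + z) → D n k (suc z) ℚ.< D n k z
  D-step-down {z} z<p h = subst₂ ℚ._<_ (sym (D≡ιA-ιB z<p)) (sym (D≡ιA-ιB (<⇒≤ z<p)))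
    (ι-sub-mono-< {A (suc z)} {B (suc z)} {A z} {B z} sums)
    where
    sums : A (suc z) + B z < A z + B (suc z)
    sums = m+n≡o+p⇒m<o (2 * (2 * Fz z + (k + z))) (2 * (2 * N + 2 * Fz (suc z)))
             (*-monoʳ-< 2 h) (D-difference p k z (Fz z) (Fz (suc z)))

  D-step-up : ∀ {z} → suc z ≤ p → 2 * Fz z + (k + z) < 2 * N + 2 * Fz (suc z) → D n k z ℚ.< D n k (suc z)
  D-step-up {z} z<p h = subst₂ ℚ._<_ (sym (D≡ιA-ιB (<⇒≤ z<p))) (sym (D≡ιA-ιB z<p))
    (ι-sub-mono-< {A z} {B z} {A (suc z)} {B (suc z)} sums)
    where
    sums : A z + B (suc z) < A (suc z) + B z
    sums = m+n≡o+p⇒m<o (2 * (2 * N + 2 * Fz (suc z))) (2 * (2 * Fz z + (k + z)))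
             (*-monoʳ-< 2 h) (sym (D-difference p k z (Fz z) (Fz (suc z))))

  Minimal : ℕ → Set
  Minimal zs = ∀ z → z ≤ p → D n k zs ℚ.≤ D n k z

  minimal⇒2N<[m+1][2m+1] : ∀ {zs} → zs ≤ p → Minimal zs → 2 * N < (k + zs + 1) * (2 * (k + zs) + 1)
  minimal⇒2N<[m+1][2m+1] {zs} zs≤p minimal = ≰⇒> no-descent
    where
    no-descent : ¬ ((k + zs + 1) * (2 * (k + zs) + 1) ≤ 2 * N)
    no-descent h = ℚ<⇒≱ (D-step-down zs<p (descent-inequality {F₀ = Fz zs} {F₁ = Fz (suc zs)}
                          m[m+1]<N (Fz-lower zs≤p) upper))
                        (minimal (suc zs) zs<p)
      where
      m[m+1]<N : (k + zs) * (k + zs + 1) < N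
      m[m+1]<N = [m+1][2m+1]≤2N⇒m[m+1]<N N (k + zs) h
      zs<p : suc zs ≤ p
      zs<p = +-cancelˡ-≤ k (suc zs) p (subst₂ _≤_ (sym (k+[1+z]≡k+z+1 zs)) (+-comm p k)
               (<⇒≤ (≤-<-trans (m≤n*m (k + zs + 1) (k + zs)) m[m+1]<N)))
      upper : 4 * ((k + zs + 1) * Fz (suc zs)) ≤ 4 * (N * N) + (k + zs + 1) * (k + zs + 1)
      upper = subst (λ x → 4 * (x * Fz (suc zs)) ≤ 4 * (N * N) + x * x) (k+[1+z]≡k+z+1 zs) (Fz-upper zs<p)

  minimal⇒2m²<2N+m : ∀ {z} → suc z ≤ p → 20 ≤ 2 * N → Minimal (suc z) →
    2 * (k + z) * (k + z) < 2 * N + (k + z)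
  minimal⇒2m²<2N+m {z} z<p 20≤2N minimal = ≰⇒> no-ascent
    where
    no-ascent : ¬ (2 * N + (k + z) ≤ 2 * (k + z) * (k + z))
    no-ascent h = ℚ<⇒≱ (D-step-up z<p (ascent-inequality {F₀ = Fz z} {F₁ = Fz (suc z)}
                         (2N+m≤2m²⇒3≤m N (k + z) 20≤2N h) k+z<N h (Fz-upper (<⇒≤ z<p)) lower))
                       (minimal z (<⇒≤ z<p))
      where
      k+z<N : k + z < N
      k+z<N = subst (k + z <_) (+-comm k p) (+-monoʳ-< k z<p)
      lower : N * N ≤ (k + z + 1) * Fz (suc z)
      lower = subst (λ x → N * N ≤ x * Fz (suc z)) (k+[1+z]≡k+z+1 z) (Fz-lower z<p)

  S≡16N+1 : S n k ≡ 16 * N + 1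
  S≡16N+1 = S≡16[p+k]+1 p k

  minimal⇒2m²+3<2N+5m : ∀ zs → zs ≤ p → 20 ≤ 2 * N → zdag-pos n k → Minimal zs →
    2 * (k + zs) * (k + zs) + 3 < 2 * N + 5 * (k + zs)
  minimal⇒2m²+3<2N+5m zero _ _ pos _ =
    subst (λ m → 2 * m * m + 3 < 2 * N + 5 * m) (sym (+-identityʳ k))
      (2m²<2N+m⇒2m²+3<2N+5m N k (s≤s z≤n) (zdag-pos⇒2k²<2N+k n k N S≡16N+1 (s≤s z≤n) pos))
  minimal⇒2m²+3<2N+5m (suc z) z<p 20≤2N _ minimal =
    subst (λ m → 2 * m * m + 3 < 2 * N + 5 * m) (sym (k+[1+z]≡k+z+1 z))
      (2m²<2N+m⇒2[m+1]²+3<2N+5[m+1] N (k + z) (minimal⇒2m²<2N+m z<p 20≤2N minimal))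

  minimal⇒floor-or-ceil : ∀ zs → zs ≤ p → 20 ≤ 2 * N → zdag-pos n k → Minimal zs →
    IsFloorZdag n k (+ zs) ⊎ IsCeilZdag n k (+ zs)
  minimal⇒floor-or-ceil zs zs≤p 20≤2N pos minimal = by-cases (2 * (k + zs) * (k + zs) ≤? 2 * N + (k + zs))
    where
    by-cases : Dec (2 * (k + zs) * (k + zs) ≤ 2 * N + (k + zs)) → IsFloorZdag n k (+ zs) ⊎ IsCeilZdag n k (+ zs)
    by-cases (yes lower) = inj₁ (IsFloorZdag-intro n k N zs S≡16N+1 lower (minimal⇒2N<[m+1][2m+1] zs≤p minimal))
    by-cases (no ¬lower) = inj₂ (IsCeilZdag-intro n k N zs S≡16N+1 (s≤s z≤n)
                             (minimal⇒2m²+3<2N+5m zs zs≤p 20≤2N pos minimal) (<⇒≤ (≰⇒> ¬lower)))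

  20≤2N : 19 ≤ n → 20 ≤ 2 * N
  20≤2N 19≤n = subst (20 ≤_) (2p+k+k≡2[p+k] p k) (+-mono-≤ 19≤n (s≤s z≤n))

  minimiser-is-floor-or-ceil : ∀ {n′} → n′ ≡ n → 19 ≤ n′ → zdag-pos n′ k
    → (zs : ℕ) → zs ≤ (n′ ∸ k) / 2
    → ((z : ℕ) → z ≤ (n′ ∸ k) / 2 → D n′ k zs ℚ.≤ D n′ k z)
    → IsFloorZdag n′ k (+ zs) ⊎ IsCeilZdag n′ k (+ zs)
  minimiser-is-floor-or-ceil refl 19≤n pos zs zs≤[n∸k]/2 minimal =
    minimal⇒floor-or-ceil zs (subst (zs ≤_) [n∸k]/2≡p zs≤[n∸k]/2) (20≤2N 19≤n) pos
      (λ z z≤p → minimal z (subst (z ≤_) (sym [n∸k]/2≡p) z≤p))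

lemma3 : (n p k : ℕ) → 1 ≤ p → 19 ≤ n → 2 * p < n → k ≡ n ∸ 2 * p → {{_ : NonZero k}}
    → zdag-pos n k
    → (zs : ℕ) → zs ≤ (n ∸ k) / 2
    → ((z : ℕ) → z ≤ (n ∸ k) / 2 → D n k zs ℚ.≤ D n k z)
    → IsFloorZdag n k (+ zs) ⊎ IsCeilZdag n k (+ zs)
lemma3 n p zero _ _ _ _ {{k≢0}} = ⊥-elim (NonZero.nonZero k≢0)
lemma3 n p (suc k′) _ 19≤n 2p<n k≡n∸2p =
  minimiser-is-floor-or-ceil p k′ n≡2p+k 19≤n
  where
  n≡2p+k : n ≡ 2 * p + suc k′
  n≡2p+k = trans (sym (m+[n∸m]≡n (<⇒≤ 2p<n))) (cong (_+_ (2 * p)) (sym k≡n∸2p))
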